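{- Let $\{G_i\}$ be a family of graphs with a common induced subgraph $J$ with embeddings $J_i$ such that $\{(G_i|J_i)\}$ is isometric, and let $H=\amalg\{(G_i|J_i)\}$. If every $G_i$ is connected and bipartite, then $\dim_l(H)=1$.
   Context: All graphs are finite, simple and non-null. $J$ is a common induced subgraph of the $G_i$ via injective maps $\iota_i:V(J)\to V(G_i)$ with $\iota_i(u)\iota_i(v)\in E(G_i)$ iff $uv\in E(J)$; $J_i$ is the induced subgraph of $G_i$ on $\iota_i(V(J))$, and $a^i=\iota_i(a)$. $H=\amalg\{(G_i|J_i)\}$ is obtained from the disjoint union of the $G_i$ by identifying, for each $a\in V(J)$, all vertices $a^i$ into one vertex (adjacencies of each $G_i$ preserved). The family is isometric if $d_{G_i}(a^i,b^i)=d_{G_j}(a^j,b^j)$ for all $i,j$ and $a,b\in V(J)$. A vertex $w$ distinguishes an edge $uv$ if $d(w,u)\ne d(w,v)$; a local metric set is a vertex set distinguishing all edges, and $\dim_l$ is the minimum size of a local metric set. -}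

module Defs where

open import Data.Nat using (ℕ; zero; suc; _≤_)
open import Data.Fin using (Fin; toℕ)
open import Data.Fin.Subset using (Subset; _∈_; ∣_∣)
open import Data.Bool using (Bool; true; false)
open import Data.Product using (Σ; ∃; _×_; _,_)
open import Data.Sum using (_⊎_)
open import Relation.Nullary using (¬_)
open import Relation.Binary.PropositionalEquality using (_≡_; _≢_)
open import Level using (Level; 0ℓ)

record SimpleGraph (n : ℕ) : Set where
  field
    adj    : Fin n → Fin n → Bool
    sym    : ∀ u v → adj u v ≡ adj v u
    irrefl : ∀ u → adj u u ≡ false

open SimpleGraph public

Edge : ∀ {n} → SimpleGraph n → Fin n → Fin n → Set
Edge G u v = adj G u v ≡ true

data Walk {n : ℕ} (G : SimpleGraph n) : Fin n → Fin n → ℕ → Set where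
  nil  : ∀ {u} → Walk G u u 0
  cons : ∀ {u v w k} → Edge G u v → Walk G v w k → Walk G u w (suc k)

-- d_G(u,v) = k  (shortest-path distance; no such k iff u,v in different components)
Dist : ∀ {n} → SimpleGraph n → Fin n → Fin n → ℕ → Set
Dist G u v k = Walk G u v k × (∀ m → Walk G u v m → k ≤ m)

Connected : ∀ {n} → SimpleGraph n → Set
Connected G = ∀ u v → ∃ λ k → Walk G u v k

Bipartite : ∀ {n} → SimpleGraph n → Set
Bipartite {n} G = Σ (Fin n → Bool) λ c → ∀ u v → Edge G u v → c u ≢ c v

-- d(w,u) = d(w,v) (as values in ℕ ∪ {∞})
SameDist : ∀ {n} → SimpleGraph n → Fin n → Fin n → Fin n → Set
SameDist G w u v = ∀ k → (Dist G w u k → Dist G w v k) × (Dist G w v k → Dist G w u k)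

Distinguishes : ∀ {n} → SimpleGraph n → Fin n → Fin n → Fin n → Set
Distinguishes G w u v = ¬ SameDist G w u v

IsLocalMetricSet : ∀ {n} → SimpleGraph n → Subset n → Set
IsLocalMetricSet G S = ∀ u v → Edge G u v → ∃ λ w → w ∈ S × Distinguishes G w u v

LocalMetricDim : ∀ {n} → SimpleGraph n → ℕ → Set
LocalMetricDim {n} G k =
  (∃ λ (S : Subset n) → IsLocalMetricSet G S × ∣ S ∣ ≡ k) ×
  (∀ (S : Subset n) → IsLocalMetricSet G S → k ≤ ∣ S ∣)

record CommonInducedSubgraph {k m : ℕ} (J : SimpleGraph k) (ns : Fin m → ℕ)
       (G : (i : Fin m) → SimpleGraph (ns i)) (ι : (i : Fin m) → Fin k → Fin (ns i)) : Set where
  field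
    injective : ∀ i a b → ι i a ≡ ι i b → a ≡ b
    induced   : ∀ i a b → adj (G i) (ι i a) (ι i b) ≡ adj J a b

Isometric : ∀ {k m} (ns : Fin m → ℕ) (G : (i : Fin m) → SimpleGraph (ns i))
            (ι : (i : Fin m) → Fin k → Fin (ns i)) → Set
Isometric ns G ι = ∀ i j a b d →
  (Dist (G i) (ι i a) (ι i b) d → Dist (G j) (ι j a) (ι j b) d) ×
  (Dist (G j) (ι j a) (ι j b) d → Dist (G i) (ι i a) (ι i b) d)

-- H (on Fin N) together with the quotient maps φ i : V(G_i) → V(H) is the
-- amalgamation ∐{(G_i | J_i)}: H is the disjoint union of the G_i with, for each
-- a ∈ V(J), all the vertices a^i = ι i a identified, and edges those of the G_i.
record IsAmalgamation {k m N : ℕ} (ns : Fin m → ℕ) (G : (i : Fin m) → SimpleGraph (ns i))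
       (ι : (i : Fin m) → Fin k → Fin (ns i))
       (H : SimpleGraph N) (φ : (i : Fin m) → Fin (ns i) → Fin N) : Set where
  field
    surjective : ∀ p → ∃ λ i → ∃ λ x → φ i x ≡ p
    identify   : ∀ i j x y →
      (φ i x ≡ φ j y) →
      ((i ≡ j × toℕ x ≡ toℕ y)
        ⊎ (∃ λ a → ι i a ≡ x × ι j a ≡ y))
    glue       : ∀ i j a → φ i (ι i a) ≡ φ j (ι j a)
    edges-in   : ∀ i x y → Edge (G i) x y → Edge H (φ i x) (φ i y)
    edges-out  : ∀ p q → Edge H p q → ∃ λ i → ∃ λ x → ∃ λ y →
                   φ i x ≡ p × φ i y ≡ q × Edge (G i) x y

-- In a connected bipartite graph the parity of d(w,u) is the colour of u relative to w, and the
-- ends of an edge have different colours; so every single vertex distinguishes every edge, and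
-- dim_l = 1 as soon as there is an edge. It therefore suffices that H is connected and bipartite.
-- Connectivity is inherited through any glued vertex a₀. For bipartiteness, recolour each G_i so
-- that a₀^i gets colour false: then a^i gets the parity of d(a^i, a₀^i), which by isometry is the
-- same in every G_i, so the recoloured colourings agree on glued vertices and descend to H.
module Submission where

open import Defs hiding (sym)
open import Data.Nat using (ℕ; zero; suc; _+_; _≤_; _<_; z≤n; s≤s)
open import Data.Nat.Properties using (≮⇒≥; ≤-<-trans; anyUpTo?)
open import Data.Nat.Induction using (<-wellFounded)
open import Induction.WellFounded using (Acc; acc)
open import Data.Fin using (Fin) renaming (zero to fzero; suc to fsuc; _≟_ to _≟ᶠ_)
open import Data.Fin.Properties using (any?; toℕ-injective)
open import Data.Fin.Subset using (⁅_⁆; ∣_∣)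
open import Data.Fin.Subset.Properties using (x∈⁅x⁆; ∣⁅x⁆∣≡1; x∈p⇒p-x⊂p; p⊂q⇒∣p∣<∣q∣)
open import Data.Bool using (Bool; true; false; not; _xor_)
open import Data.Bool.Properties using (¬-not; xor-same; not-distribˡ-xor) renaming (_≟_ to _≟ᵇ_)
open import Data.Product using (∃; _×_; _,_; proj₁; proj₂)
open import Data.Sum using (inj₁; inj₂)
open import Function using (_∘_)
open import Relation.Nullary using (Dec; yes; no)
open import Relation.Nullary.Decidable using (_×-dec_)
open import Relation.Unary using (Pred; Decidable)
open import Relation.Binary.PropositionalEquality using (_≡_; _≢_; refl; sym; trans; cong; module ≡-Reasoning)

odd : ℕ → Bool
odd zero    = false
odd (suc k) = not (odd k)

xor-cancelˡ : ∀ x {y z} → x xor y ≡ x xor z → y ≡ z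
xor-cancelˡ false eq = eq
xor-cancelˡ true {false} {false} eq = refl
xor-cancelˡ true {true}  {true}  eq = refl
xor-cancelˡ true {false} {true}  ()
xor-cancelˡ true {true}  {false} ()

least-witness : ∀ {p} {P : Pred ℕ p} → Decidable P → ∀ {k} → P k →
                ∃ λ d → P d × (∀ m → P m → d ≤ m)
least-witness {P = P} P? {k} Pk = go (<-wellFounded k) Pk
  where
  go : ∀ {k} → Acc _<_ k → P k → ∃ λ d → P d × (∀ m → P m → d ≤ m)
  go {k} (acc below) Pk with anyUpTo? P? k
  ... | yes (n , n<k , Pn) = go (below n<k) Pn
  ... | no none            = k , Pk , λ m Pm → ≮⇒≥ λ m<k → none (m , m<k , Pm)

module _ {n : ℕ} {G : SimpleGraph n} where

  walk? : ∀ k u v → Dec (Walk G u v k)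
  walk? zero u v with u ≟ᶠ v
  ... | yes refl = yes nil
  ... | no u≢v   = no λ { nil → u≢v refl }
  walk? (suc k) u v with any? (λ w → (adj G u w ≟ᵇ true) ×-dec walk? k w v)
  ... | yes (w , e , p) = yes (cons e p)
  ... | no none         = no λ { (cons e p) → none (_ , e , p) }

  walk⇒dist : ∀ {u v k} → Walk G u v k → ∃ (Dist G u v)
  walk⇒dist {u} {v} = least-witness (λ k → walk? k u v)

  _++ʷ_ : ∀ {x y z a b} → Walk G x y a → Walk G y z b → Walk G x z (a + b)
  nil      ++ʷ q = q
  cons e p ++ʷ q = cons e (p ++ʷ q)

  walk-colour : (c : Fin n → Bool) → (∀ u v → Edge G u v → c u ≢ c v) →
                ∀ {u v k} → Walk G u v k → c u xor c v ≡ odd k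
  walk-colour c proper {u} nil = xor-same (c u)
  walk-colour c proper {u} {v} (cons {v = w} {k = k} e p) = begin
    c u xor c v       ≡⟨ cong (_xor c v) (¬-not (proper _ _ e)) ⟩
    not (c w) xor c v ≡⟨ sym (not-distribˡ-xor (c w) (c v)) ⟩
    not (c w xor c v) ≡⟨ cong not (walk-colour c proper p) ⟩
    odd (suc k)       ∎
    where open ≡-Reasoning

  connected-has-edge : 2 ≤ n → Connected G → ∃ λ u → ∃ λ v → Edge G u v
  connected-has-edge (s≤s (s≤s z≤n)) conn with conn fzero (fsuc fzero)
  ... | _ , cons e _ = _ , _ , e

  bipartite-distinguishes : Connected G → Bipartite G →
                            ∀ w {u v} → Edge G u v → Distinguishes G w u v
  bipartite-distinguishes conn (c , proper) w {u} {v} e same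
    with walk⇒dist (proj₂ (conn w u))
  ... | d , w→u = proper u v e (xor-cancelˡ (c w) (trans (walk-colour c proper (proj₁ w→u))
                                                          (sym (walk-colour c proper (proj₁ w→v)))))
    where
    w→v : Dist G w v d
    w→v = proj₁ (same d) w→u

  local-metric-set-nonempty : ∀ {u v} → Edge G u v → ∀ S → IsLocalMetricSet G S → 1 ≤ ∣ S ∣
  local-metric-set-nonempty e S lms with lms _ _ e
  ... | w , w∈S , _ = ≤-<-trans z≤n (p⊂q⇒∣p∣<∣q∣ (x∈p⇒p-x⊂p w∈S))

  bipartite-localMetricDim : Connected G → Bipartite G → ∀ {u v} → Edge G u v →
                             LocalMetricDim G 1
  bipartite-localMetricDim conn bip {u} e =
    (⁅ u ⁆ , (λ _ _ e′ → u , x∈⁅x⁆ u , bipartite-distinguishes conn bip u e′) , ∣⁅x⁆∣≡1 u) ,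
    local-metric-set-nonempty e

walk-map : ∀ {n N} {G : SimpleGraph n} {H : SimpleGraph N} (f : Fin n → Fin N) →
           (∀ x y → Edge G x y → Edge H (f x) (f y)) →
           ∀ {x y k} → Walk G x y k → Walk H (f x) (f y) k
walk-map f hom nil        = nil
walk-map f hom (cons e p) = cons (hom _ _ e) (walk-map f hom p)

module Amalgamation {k m N : ℕ} {ns : Fin m → ℕ} {G : (i : Fin m) → SimpleGraph (ns i)}
  {ι : (i : Fin m) → Fin k → Fin (ns i)} {H : SimpleGraph N} {φ : (i : Fin m) → Fin (ns i) → Fin N}
  (amal : IsAmalgamation ns G ι H φ) (conn : ∀ i → Connected (G i)) (a₀ : Fin k) where

  open IsAmalgamation amal

  amalgamation-connected : Connected H
  amalgamation-connected p q with surjective p | surjective q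
  ... | i , x , refl | j , y , refl with conn i x (ι i a₀) | conn j (ι j a₀) y
  ... | _ , x→a₀ | _ , a₀→y =
    _ , walk-map (φ i) (edges-in i) x→a₀ ++ʷ glued (walk-map (φ j) (edges-in j) a₀→y)
    where
    glued : ∀ {z l} → Walk H (φ j (ι j a₀)) z l → Walk H (φ i (ι i a₀)) z l
    glued w rewrite glue i j a₀ = w

  module _ (iso : Isometric ns G ι) (bip : ∀ i → Bipartite (G i)) where

    colour : ∀ i → Fin (ns i) → Bool
    colour i x = proj₁ (bip i) (ι i a₀) xor proj₁ (bip i) x

    colour-proper : ∀ i x y → Edge (G i) x y → colour i x ≢ colour i y
    colour-proper i x y e = proj₂ (bip i) x y e ∘ xor-cancelˡ (proj₁ (bip i) (ι i a₀))

    colour-glued : ∀ i j a → colour i (ι i a) ≡ colour j (ι j a)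
    colour-glued i j a with walk⇒dist (proj₂ (conn i (ι i a₀) (ι i a)))
    ... | d , dist-i = trans (walk-colour (proj₁ (bip i)) (proj₂ (bip i)) (proj₁ dist-i))
                             (sym (walk-colour (proj₁ (bip j)) (proj₂ (bip j)) (proj₁ dist-j)))
      where
      dist-j : Dist (G j) (ι j a₀) (ι j a) d
      dist-j = proj₁ (iso i j a₀ a d) dist-i

    colour-respects-φ : ∀ i j x y → φ i x ≡ φ j y → colour i x ≡ colour j y
    colour-respects-φ i j x y eq with identify i j x y eq
    ... | inj₁ (refl , x≡y)      = cong (colour i) (toℕ-injective x≡y)
    ... | inj₂ (a , refl , refl) = colour-glued i j a

    colourᴴ : Fin N → Bool
    colourᴴ p = let i , x , _ = surjective p in colour i x

    colourᴴ-φ : ∀ i x → colourᴴ (φ i x) ≡ colour i x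
    colourᴴ-φ i x = let j , y , eq = surjective (φ i x) in colour-respects-φ j i y x eq

    amalgamation-bipartite : Bipartite H
    amalgamation-bipartite = colourᴴ , proper
      where
      proper : ∀ p q → Edge H p q → colourᴴ p ≢ colourᴴ q
      proper p q e with edges-out p q e
      ... | i , x , y , refl , refl , exy =
        λ same → colour-proper i x y exy (trans (sym (colourᴴ-φ i x)) (trans same (colourᴴ-φ i y)))

corollary1 : ∀ {k m N : ℕ} (J : SimpleGraph k) (ns : Fin m → ℕ)
    (G : (i : Fin m) → SimpleGraph (ns i)) (ι : (i : Fin m) → Fin k → Fin (ns i))
    (H : SimpleGraph N) (φ : (i : Fin m) → Fin (ns i) → Fin N) →
    1 ≤ k → (∀ i → 1 ≤ ns i) →
    CommonInducedSubgraph J ns G ι →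
    Isometric ns G ι →
    IsAmalgamation ns G ι H φ →
    (∀ i → Connected (G i)) →
    (∀ i → Bipartite (G i)) →
    (∃ λ i → 2 ≤ ns i) →
    LocalMetricDim H 1
corollary1 {suc _} J ns G ι H φ _ _ _ iso amal conn bip (i , 2≤ns)
  with connected-has-edge 2≤ns (conn i)
... | u , v , e =
  bipartite-localMetricDim amalgamation-connected (amalgamation-bipartite iso bip) (edges-in i u v e)
  where
  open IsAmalgamation amal using (edges-in)
  open Amalgamation amal conn fzero
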